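{- Let $n\ge2$ and suppose the word $\underline{b}$ immediately follows the word $\underline{a}$ in $G_n$; let $k$ be the index with $b_k\ne a_k$. If $b_k=a_k+1$ and $\underline{a}$ is arc-disconnected, then $\underline{b}$ is arc-disconnected; and if $b_k=a_k-1$ and $\underline{a}$ is arc-connected, then $\underline{b}$ is arc-connected.
   Context: The list $G_n$ of words $a_1\cdots a_n$ (with $1\le a_i\le 2i-1$) is defined recursively: $G_1=(1)$; for $n\ge2$, if $G_{n-1}=(w_1,\ldots,w_N)$, then $G_n$ is the concatenation over $m=1,\ldots,N$ of the blocks $(w_m1,\ldots,w_m(2n-1))$ for $m$ odd and $(w_m(2n-1),\ldots,w_m1)$ for $m$ even, where $w_mx$ denotes $w_m$ with the letter $x$ appended; consecutive words differ in exactly one position. For a word $a_1\cdots a_n$, $\pi(a_1\cdots a_n)$ is the standard permutation of $\{\pm1,\ldots,\pm n\}$ defined recursively by $\pi(a_1)=(1,-1)$ and, for $n\ge2$, by inserting $n$ into $\pi(a_1\cdots a_{n-1})$ so that it occupies position $a_n$ and appending $-n$ at the end. A permutation $\pi$ of $\{\pm1,\ldots,\pm n\}$ is sign-connected if for every $1\le m<2n$ there is $j$ with $|\{\pi(1),\ldots,\pi(m)\}\cap\{ -j,j\}|=1$. A word $\underline{a}$ is arc-connected if $\pi(\underline{a})$ is sign-connected, and arc-disconnected otherwise. -}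

module Defs where

open import Data.Nat using (ℕ; zero; suc; _+_; _*_; _∸_; _≤_; _<_)
open import Data.Integer using (ℤ; +_; -_)
open import Data.List using (List; []; _∷_; _++_; map; concat; take; drop; length; upTo)
open import Data.List.Membership.Propositional using (_∈_)
open import Data.Bool using (Bool; true; false; not)
open import Data.Product using (Σ; _×_; ∃-syntax)
open import Data.Sum using (_⊎_)
open import Relation.Nullary using (¬_)
open import Relation.Binary.PropositionalEquality using (_≡_)

-- A word a₁⋯aₙ is the list (a₁ ∷ … ∷ aₙ ∷ []) of positive naturals.
Word : Set
Word = List ℕ

oneTo : ℕ → List ℕ
oneTo k = map suc (upTo k)

rev : {A : Set} → List A → List A
rev [] = []
rev (x ∷ xs) = rev xs ++ (x ∷ [])

-- One block: w appended with 1,…,2n−1 (ascending, odd position m)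
-- or with 2n−1,…,1 (descending, even position m).
block : ℕ → Bool → Word → List Word
block n true  w = map (λ x → w ++ (x ∷ [])) (oneTo (2 * n ∸ 1))
block n false w = map (λ x → w ++ (x ∷ [])) (rev (oneTo (2 * n ∸ 1)))

-- Concatenate blocks over w₁,…,w_N; the flag is true iff the index m is odd.
blocks : ℕ → Bool → List Word → List Word
blocks n b [] = []
blocks n b (w ∷ ws) = block n b w ++ blocks n (not b) ws

-- The list G_n (G 0 is unused and set to the empty list).
G : ℕ → List Word
G zero = []
G (suc zero) = (1 ∷ []) ∷ []
G (suc (suc n)) = blocks (suc (suc n)) true (G (suc n))

Follows : Word → Word → List Word → Set
Follows a b L = ∃[ xs ] ∃[ ys ] (L ≡ xs ++ (a ∷ b ∷ ys))

-- letter at 0-based position k (default 0 outside the word; letters are ≥ 1)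
at : Word → ℕ → ℕ
at [] k = 0
at (x ∷ xs) zero = x
at (x ∷ xs) (suc k) = at xs k

-- insert x so that it occupies (1-based) position p
insertAt : ℕ → ℤ → List ℤ → List ℤ
insertAt p x l = take (p ∸ 1) l ++ (x ∷ drop (p ∸ 1) l)

-- π(a₁⋯aₙ) as the list π(1),…,π(2n)
permAux : ℕ → List ℤ → Word → List ℤ
permAux k acc [] = acc
permAux k acc (a ∷ as) = permAux (suc k) (insertAt a (+ k) acc ++ ((- (+ k)) ∷ [])) as

perm : Word → List ℤ
perm [] = []
perm (a₁ ∷ as) = permAux 2 ((+ 1) ∷ (- (+ 1)) ∷ []) as

SignConnected : List ℤ → Set
SignConnected p =
  (m : ℕ) → 1 ≤ m → m < length p →
  ∃[ j ] (1 ≤ j ×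
    (((+ j) ∈ take m p × ¬ ((- (+ j)) ∈ take m p))
     ⊎ (¬ ((+ j) ∈ take m p) × (- (+ j)) ∈ take m p)))

ArcConnected : Word → Set
ArcConnected a = SignConnected (perm a)

ArcDisconnected : Word → Set
ArcDisconnected a = ¬ ArcConnected a

module Submission where

-- Consecutive words of G_n differ in one letter, and lowering a letter by one
-- can only help sign-connectivity: if  P ++ (c+1) ∷ S  is arc-connected then
-- so is  P ++ c ∷ S.
--
-- Inside a block only the appended letter changes;
--    across a block boundary the appended letter is the same (a block ends
--    where the next, reversed, block starts) and the prefixes are consecutive
--    in G_{n-1}.  Building π letter by letter, the two words give the same
--    list until the changed letter, where the new entry y = t+1 is inserted
--    once just after and once just before its neighbour x.  The relation
--    'Swapped' (the two lists differ by exchanging x and y, and -y does not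
--    occur before y) survives every later insertion and every appended entry,
--    and it transfers sign-connectivity: a prefix of the second list either
--    has the same entries as the prefix of the first one, or contains y but
--    not -y.

open import Defs
open import Data.Nat using (ℕ; zero; suc; _≤_; _<_; _*_; _∸_; z≤n; s≤s)
open import Data.Nat.Properties using (≤-refl; m≤n⇒m≤1+n; 1+n≰n)
open import Data.Integer using (ℤ; +_; -_; -[1+_]; ∣_∣)
open import Data.List using (List; []; _∷_; _++_; _∷ʳ_; map; take; drop; head; last)
open import Data.List.Properties using (++-assoc; ++-identityʳ; take++drop≡id; last-map)
open import Data.List.Relation.Unary.Any using (here)
open import Data.List.Relation.Unary.All as All using (All; []; _∷_)
open import Data.List.Relation.Unary.All.Properties using (++⁺; ++⁻ˡ; ++⁻ʳ; take⁺; All¬⇒¬Any)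
open import Data.List.Relation.Unary.Linked as Linked using (Linked; []; [-]; _∷_)
import Data.List.Relation.Unary.Linked.Properties as Linked
open import Data.List.Membership.Propositional using (_∈_)
open import Data.List.Membership.Propositional.Properties using (∈-++⁺ʳ)
open import Data.List.Relation.Binary.Permutation.Propositional
  using (_↭_; ↭-refl; ↭-sym; ↭-trans; ↭-reflexive; ↭-swap; module PermutationReasoning)
open import Data.List.Relation.Binary.Permutation.Propositional.Properties
  using (shift; ++⁺ˡ; ∈-resp-↭; All-resp-↭; ↭-length)
open import Data.Maybe as Maybe using (just)
open import Data.Maybe.Relation.Binary.Connected using (Connected; just)
open import Data.Bool using (Bool; true; false; not)
open import Data.Product using (_×_; _,_; proj₁; proj₂; ∃-syntax)
open import Data.Sum using (_⊎_; inj₁; inj₂)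
open import Data.Empty using (⊥-elim)
open import Relation.Nullary using (¬_)
open import Relation.Binary.PropositionalEquality
  using (_≡_; _≢_; refl; sym; trans; cong; subst; subst₂; module ≡-Reasoning)

linked-middle : ∀ {A : Set} {R : A → A → Set} xs {a b ys} →
  Linked R (xs ++ a ∷ b ∷ ys) → R a b
linked-middle []       l = Linked.head l
linked-middle (x ∷ xs) l = linked-middle xs (Linked.tail l)

linked-++ : ∀ {A : Set} {R : A → A → Set} {xs ys x y} →
  last xs ≡ just x → head ys ≡ just y → R x y →
  Linked R xs → Linked R ys → Linked R (xs ++ ys)
linked-++ {R = R} lx hy r lxs lys =
  Linked.++⁺ lxs (subst₂ (Connected R) (sym lx) (sym hy) (just r)) lys

last-∷ʳ : ∀ {A : Set} (xs : List A) x → last (xs ∷ʳ x) ≡ just x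
last-∷ʳ []           x = refl
last-∷ʳ (_ ∷ [])     x = refl
last-∷ʳ (_ ∷ y ∷ xs) x = last-∷ʳ (y ∷ xs) x

rev-∷ʳ : ∀ {A : Set} (xs : List A) x → rev (xs ∷ʳ x) ≡ x ∷ rev xs
rev-∷ʳ []       x = refl
rev-∷ʳ (y ∷ xs) x = cong (_∷ʳ y) (rev-∷ʳ xs x)

ins : ∀ {A : Set} → ℕ → A → List A → List A
ins j z l = take j l ++ z ∷ drop j l

ins-↭ : ∀ {A : Set} j (z : A) l → ins j z l ↭ z ∷ l
ins-↭ j z l = ↭-trans (shift z (take j l) (drop j l))
                      (↭-reflexive (cong (z ∷_) (take++drop≡id j l)))

all-ins : ∀ {A : Set} {P : A → Set} j {z l} → P z → All P l → All P (ins j z l)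
all-ins j {z} {l} pz pl = All-resp-↭ (↭-sym (ins-↭ j z l)) (pz ∷ pl)

take-around : ∀ {A : Set} (B : List A) m →
  (∀ u C → take m (B ++ u ∷ C) ≡ take m B)
  ⊎ (∃[ m′ ] ∀ u C → take m (B ++ u ∷ C) ≡ B ++ u ∷ take m′ C)
take-around B       zero    = inj₁ λ _ _ → refl
take-around []      (suc m) = inj₂ (m , λ _ _ → refl)
take-around (b ∷ B) (suc m) with take-around B m
... | inj₁ eq        = inj₁ λ u C → cong (b ∷_) (eq u C)
... | inj₂ (m′ , eq) = inj₂ (m′ , λ u C → cong (b ∷_) (eq u C))

ins-around : ∀ {A : Set} (z : A) (B : List A) j →
  (∀ u C → ins j z (B ++ u ∷ C) ≡ ins j z B ++ u ∷ C)
  ⊎ (∃[ j′ ] ∀ u C → ins j z (B ++ u ∷ C) ≡ B ++ u ∷ ins j′ z C)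
ins-around z B       zero    = inj₁ λ _ _ → refl
ins-around z []      (suc j) = inj₂ (j , λ _ _ → refl)
ins-around z (b ∷ B) (suc j) with ins-around z B j
... | inj₁ eq        = inj₁ λ u C → cong (b ∷_) (eq u C)
... | inj₂ (j′ , eq) = inj₂ (j′ , λ u C → cong (b ∷_) (eq u C))

ins-consecutive : ∀ {A : Set} (z : A) i L →
  ins (suc i) z L ≡ ins i z L
  ⊎ ∃[ P ] ∃[ x ] ∃[ R ] (L ≡ P ++ x ∷ R × ins (suc i) z L ≡ P ++ x ∷ z ∷ R
                                          × ins i z L ≡ P ++ z ∷ x ∷ R)
ins-consecutive z zero    []      = inj₁ refl
ins-consecutive z (suc i) []      = inj₁ refl
ins-consecutive z zero    (x ∷ R) = inj₂ ([] , x , R , refl , refl , refl)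
ins-consecutive z (suc i) (x ∷ R) with ins-consecutive z i R
... | inj₁ eq = inj₁ (cong (x ∷_) eq)
... | inj₂ (P , x′ , R′ , e , e₁ , e₂) =
  inj₂ (x ∷ P , x′ , R′ , cong (x ∷_) e , cong (x ∷_) e₁ , cong (x ∷_) e₂)

transpose-↭ : ∀ {A : Set} (P : List A) x y B D → P ++ x ∷ B ++ y ∷ D ↭ P ++ y ∷ B ++ x ∷ D
transpose-↭ P x y B D = ++⁺ˡ P (begin
  x ∷ B ++ y ∷ D   ↭⟨ ↭-sym (shift x B (y ∷ D)) ⟩
  B ++ x ∷ y ∷ D   ↭⟨ ++⁺ˡ B (↭-swap x y ↭-refl) ⟩
  B ++ y ∷ x ∷ D   ↭⟨ shift y B (x ∷ D) ⟩
  y ∷ B ++ x ∷ D   ∎)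
  where open PermutationReasoning

prefix-transposed : ∀ {A : Set} (P : List A) x y B C m →
  take m (P ++ x ∷ B ++ y ∷ C) ↭ take m (P ++ y ∷ B ++ x ∷ C)
  ⊎ ∃[ r ] take m (P ++ y ∷ B ++ x ∷ C) ≡ P ++ y ∷ take r B
prefix-transposed P x y B C m with take-around P m
... | inj₁ eq = inj₁ (↭-reflexive (trans (eq x _) (sym (eq y _))))
... | inj₂ (m′ , eq) with take-around B m′
...   | inj₁ eq′ = inj₂ (m′ , trans (eq y _) (cong (λ r → P ++ y ∷ r) (eq′ x C)))
...   | inj₂ (m″ , eq′) rewrite eq x (B ++ y ∷ C) | eq y (B ++ x ∷ C) | eq′ y C | eq′ x C =
  inj₁ (transpose-↭ P x y B (take m″ C))

data Adjacent : Word → Word → Set where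
  differ-at : ∀ P c d S → Adjacent (P ++ c ∷ S) (P ++ d ∷ S)

adjacent-∷ʳ : ∀ {w w′} e → Adjacent w w′ → Adjacent (w ∷ʳ e) (w′ ∷ʳ e)
adjacent-∷ʳ e (differ-at P c d S) =
  subst₂ Adjacent (sym (++-assoc P (c ∷ S) _)) (sym (++-assoc P (d ∷ S) _))
         (differ-at P c d (S ∷ʳ e))

linked-extensions : ∀ w l → Linked Adjacent (map (w ∷ʳ_) l)
linked-extensions w []          = []
linked-extensions w (x ∷ [])    = [-]
linked-extensions w (x ∷ y ∷ l) = differ-at w x y [] ∷ linked-extensions w (y ∷ l)

Ends : List ℕ → ℕ → ℕ → Set
Ends l s e = (∃[ r ] l ≡ s ∷ r) × (∃[ i ] l ≡ i ∷ʳ e)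

ends-nonempty : ∀ h t → ∃[ e ] Ends (h ∷ t) h e
ends-nonempty h []      = h , (_ , refl) , ([] , refl)
ends-nonempty h (h′ ∷ t) with ends-nonempty h′ t
... | e , _ , (i , eq) = e , (_ , refl) , (h ∷ i , cong (h ∷_) eq)

last-of-ends : ∀ {l s e} → Ends l s e → last l ≡ just e
last-of-ends (_ , (i , finishes)) = trans (cong last finishes) (last-∷ʳ i _)

ends-rev : ∀ {l s e} → Ends l s e → Ends (rev l) e s
ends-rev ((r , starts) , (i , finishes)) =
  (rev i , trans (cong rev finishes) (rev-∷ʳ i _)) , (rev r , cong rev starts)

-- The blocks of G_n append the letters 1,…,2n−1 alternately forwards and
-- backwards; given where the forward run starts (s) and ends (e), each run
-- ends with the letter the next one starts with.
module Serpentine (n s e : ℕ) (forward : Ends (oneTo (2 * n ∸ 1)) s e) where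

  first : Bool → ℕ
  first true  = s
  first false = e

  letters : Bool → List ℕ
  letters true  = oneTo (2 * n ∸ 1)
  letters false = rev (oneTo (2 * n ∸ 1))

  ends : ∀ b → Ends (letters b) (first b) (first (not b))
  ends true  = forward
  ends false = ends-rev forward

  block-letters : ∀ b w → block n b w ≡ map (w ∷ʳ_) (letters b)
  block-letters true  w = refl
  block-letters false w = refl

  block-head : ∀ b w ys → head (block n b w ++ ys) ≡ just (w ∷ʳ first b)
  block-head b w ys rewrite block-letters b w | proj₂ (proj₁ (ends b)) = refl

  block-last : ∀ b w → last (block n b w) ≡ just (w ∷ʳ first (not b))
  block-last b w = begin
    last (block n b w)                    ≡⟨ cong last (block-letters b w) ⟩
    last (map (w ∷ʳ_) (letters b))        ≡⟨ last-map (w ∷ʳ_) (letters b) ⟩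
    Maybe.map (w ∷ʳ_) (last (letters b))  ≡⟨ cong (Maybe.map (w ∷ʳ_)) (last-of-ends (ends b)) ⟩
    just (w ∷ʳ first (not b))             ∎
    where open ≡-Reasoning

  linked-block : ∀ b w → Linked Adjacent (block n b w)
  linked-block true  w = linked-extensions w (letters true)
  linked-block false w = linked-extensions w (letters false)

  -- Consecutive blocks meet in adjacent words, because the prefixes are
  -- adjacent and the appended letter is the same.
  linked-blocks : ∀ b ws → Linked Adjacent ws → Linked Adjacent (blocks n b ws)
  linked-blocks b []            _ = []
  linked-blocks b (w ∷ [])      _ =
    subst (Linked Adjacent) (sym (++-identityʳ (block n b w))) (linked-block b w)
  linked-blocks b (w ∷ w′ ∷ ws) (adj ∷ rest) =
    linked-++ (block-last b w) (block-head (not b) w′ _) (adjacent-∷ʳ _ adj)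
              (linked-block b w) (linked-blocks (not b) (w′ ∷ ws) rest)

linked-G : ∀ n → Linked Adjacent (G n)
linked-G zero          = []
linked-G (suc zero)    = [-]
linked-G (suc (suc n)) =
  Serpentine.linked-blocks (suc (suc n)) 1 (proj₁ forward) (proj₂ forward)
                           true (G (suc n)) (linked-G (suc n))
  where
  forward : ∃[ e ] Ends (oneTo (2 * suc (suc n) ∸ 1)) 1 e
  forward = ends-nonempty 1 _

adjacent-of-follows : ∀ n {a b} → Follows a b (G n) → Adjacent a b
adjacent-of-follows n (xs , ys , eq) = linked-middle xs (subst (Linked Adjacent) eq (linked-G n))

changed-letter : ∀ P (c d : ℕ) S k → at (P ++ c ∷ S) k ≢ at (P ++ d ∷ S) k →
  at (P ++ c ∷ S) k ≡ c × at (P ++ d ∷ S) k ≡ d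
changed-letter []      c d S zero    _  = refl , refl
changed-letter []      c d S (suc k) ne = ⊥-elim (ne refl)
changed-letter (_ ∷ P) c d S zero    ne = ⊥-elim (ne refl)
changed-letter (_ ∷ P) c d S (suc k) ne = changed-letter P c d S k ne

Unbalanced : List ℤ → Set
Unbalanced S = ∃[ j ] (1 ≤ j ×
  (((+ j) ∈ S × ¬ ((- (+ j)) ∈ S)) ⊎ (¬ ((+ j) ∈ S) × (- (+ j)) ∈ S)))

unbalanced-↭ : ∀ {S S′} → S ↭ S′ → Unbalanced S → Unbalanced S′
unbalanced-↭ σ (j , 1≤j , inj₁ (pos , ¬neg)) =
  j , 1≤j , inj₁ (∈-resp-↭ σ pos , λ neg → ¬neg (∈-resp-↭ (↭-sym σ) neg))
unbalanced-↭ σ (j , 1≤j , inj₂ (¬pos , neg)) =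
  j , 1≤j , inj₂ ((λ pos → ¬pos (∈-resp-↭ (↭-sym σ) pos)) , ∈-resp-↭ σ neg)

module Transposition (t : ℕ) where

  y ȳ : ℤ
  y = + suc t
  ȳ = -[1+ t ]

  data Swapped : List ℤ → List ℤ → Set where
    swapped : ∀ A x B C → All (ȳ ≢_) A → All (ȳ ≢_) (x ∷ B) →
              Swapped (A ++ x ∷ B ++ y ∷ C) (A ++ y ∷ B ++ x ∷ C)

  -- Moving y forward keeps every prefix unbalanced: a prefix that separates
  -- y from x contains y but not -y.
  swapped-connected : ∀ {p q} → Swapped p q → SignConnected p → SignConnected q
  swapped-connected (swapped A x B C ȳ∉A ȳ∉xB) conn m 1≤m m<q
    with prefix-transposed A x y B C m
  ... | inj₁ same =
    unbalanced-↭ same (conn m 1≤m (subst (m <_) (↭-length (↭-sym (transpose-↭ A x y B C))) m<q))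
  ... | inj₂ (r , eq) rewrite eq =
    suc t , s≤s z≤n , inj₁ (∈-++⁺ʳ A (here refl) , All¬⇒¬Any avoids)
    where
    avoids : All (ȳ ≢_) (A ++ y ∷ take r B)
    avoids = ++⁺ ȳ∉A ((λ ()) ∷ take⁺ r (All.tail ȳ∉xB))

  swapped-ins : ∀ {p q} j z → ȳ ≢ z → Swapped p q → Swapped (ins j z p) (ins j z q)
  swapped-ins j z ȳ≢z (swapped A x B C ȳ∉A ȳ∉xB) with ins-around z A j
  ... | inj₁ eq rewrite eq x (B ++ y ∷ C) | eq y (B ++ x ∷ C) =
    swapped (ins j z A) x B C (all-ins j ȳ≢z ȳ∉A) ȳ∉xB
  ... | inj₂ (j′ , eq) rewrite eq x (B ++ y ∷ C) | eq y (B ++ x ∷ C) with ins-around z B j′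
  ...   | inj₁ eq′ rewrite eq′ y C | eq′ x C =
    swapped A x (ins j′ z B) C ȳ∉A (All.head ȳ∉xB ∷ all-ins j′ ȳ≢z (All.tail ȳ∉xB))
  ...   | inj₂ (j″ , eq′) rewrite eq′ y C | eq′ x C =
    swapped A x B (ins j″ z C) ȳ∉A ȳ∉xB

  swapped-∷ʳ : ∀ {p q} z → Swapped p q → Swapped (p ∷ʳ z) (q ∷ʳ z)
  swapped-∷ʳ z (swapped A x B C ȳ∉A ȳ∉xB) =
    subst₂ Swapped (sym (append-inside x y)) (sym (append-inside y x))
           (swapped A x B (C ∷ʳ z) ȳ∉A ȳ∉xB)
    where
    append-inside : ∀ u v → (A ++ u ∷ B ++ v ∷ C) ∷ʳ z ≡ A ++ u ∷ B ++ v ∷ (C ∷ʳ z)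
    append-inside u v = trans (++-assoc A (u ∷ B ++ v ∷ C) _)
                              (cong (λ r → A ++ u ∷ r) (++-assoc B (v ∷ C) _))

  -- The later steps of the construction of π insert and append entries
  -- ±k ≠ -y, so they keep the two lists swapped.
  swapped-permAux : ∀ {p q} w k → Swapped p q → Swapped (permAux k p w) (permAux k q w)
  swapped-permAux []      k s = s
  swapped-permAux (a ∷ w) k s =
    swapped-permAux w (suc k) (swapped-∷ʳ _ (swapped-ins (a ∸ 1) (+ k) (λ ()) s))

open Transposition using (swapped; swapped-connected; swapped-permAux)

Bounded : ℕ → List ℤ → Set
Bounded t = All (λ z → ∣ z ∣ ≤ t)

bounded-step : ∀ {t} j acc → Bounded t acc → Bounded (suc t) (ins j (+ suc t) acc ∷ʳ -[1+ t ])
bounded-step j acc bnd = ++⁺ (all-ins j ≤-refl (All.map m≤n⇒m≤1+n bnd)) (≤-refl ∷ [])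

bounded-avoids : ∀ {t z} → ∣ z ∣ ≤ t → -[1+ t ] ≢ z
bounded-avoids bnd refl = 1+n≰n bnd

-- The changed letter itself: y = t+1 is inserted one place further left.
connected-lower-first : ∀ t acc → Bounded t acc → ∀ c S →
  SignConnected (permAux (suc t) acc (suc c ∷ S)) → SignConnected (permAux (suc t) acc (c ∷ S))
connected-lower-first t acc bnd zero    S conn = conn
connected-lower-first t acc bnd (suc i) S conn with ins-consecutive (+ suc t) i acc
... | inj₁ same =
  subst (λ l → SignConnected (permAux (suc (suc t)) (l ∷ʳ -[1+ t ]) S)) same conn
... | inj₂ (P , x , R , refl , after , before) =
  swapped-connected t (swapped-permAux t S (suc (suc t)) transposed) conn
  where
  transposed : Transposition.Swapped t (ins (suc i) (+ suc t) (P ++ x ∷ R) ∷ʳ -[1+ t ])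
                                       (ins i (+ suc t) (P ++ x ∷ R) ∷ʳ -[1+ t ])
  transposed rewrite after | before =
    subst₂ (Transposition.Swapped t) (sym (++-assoc P _ _)) (sym (++-assoc P _ _))
      (swapped P x [] (R ∷ʳ -[1+ t ])
               (All.map bounded-avoids (++⁻ˡ P bnd))
               (bounded-avoids (All.head (++⁻ʳ P bnd)) ∷ []))

-- Before the changed letter both words build the same list.
connected-lower : ∀ P c S t acc → Bounded t acc →
  SignConnected (permAux (suc t) acc (P ++ suc c ∷ S)) →
  SignConnected (permAux (suc t) acc (P ++ c ∷ S))
connected-lower []      c S t acc bnd = connected-lower-first t acc bnd c S
connected-lower (p ∷ P) c S t acc bnd =
  connected-lower P c S (suc t) _ (bounded-step (p ∸ 1) acc bnd)

-- π ignores the first letter; afterwards the construction starts from (1, -1).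
arc-connected-lower : ∀ P c S → ArcConnected (P ++ suc c ∷ S) → ArcConnected (P ++ c ∷ S)
arc-connected-lower []      c S conn = conn
arc-connected-lower (_ ∷ P) c S =
  connected-lower P c S 1 (+ 1 ∷ -[1+ 0 ] ∷ []) (s≤s z≤n ∷ s≤s z≤n ∷ [])

lemma5p9 : (n : ℕ) → 2 ≤ n → (a b : Word) → Follows a b (G n) →
    (k : ℕ) → k < n → at a k ≢ at b k →
    ((at b k ≡ suc (at a k)) → ArcDisconnected a → ArcDisconnected b)
    × ((suc (at b k) ≡ at a k) → ArcConnected a → ArcConnected b)
lemma5p9 n _ a b follows k _ a≢b with adjacent-of-follows n follows
... | differ-at P c d S with changed-letter P c d S k a≢b
... | at-a , at-b rewrite at-a | at-b = raise , lower
  where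
  raise : d ≡ suc c → ArcDisconnected (P ++ c ∷ S) → ArcDisconnected (P ++ d ∷ S)
  raise refl a-disconnected b-connected = a-disconnected (arc-connected-lower P c S b-connected)
  lower : suc d ≡ c → ArcConnected (P ++ c ∷ S) → ArcConnected (P ++ d ∷ S)
  lower refl = arc-connected-lower P d S
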